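{- Let $n\ge 6$ and let $u$ be a sequence on $n$ distinct letters such that every letter occurs at least twice, $fw(u)=4$, $u$ has alternation length $5$, and the first $n$ letters of $u$ are $1\,2\ldots n$. If both the last letter and the middle letter of $u$ are $2$, then $u=1\,2\ldots n\;2\;1\;3\ldots n\;2$.
   Context: A sequence $s$ contains $u$ if some (not necessarily contiguous) subsequence of $s$ can be changed into $u$ by a one-to-one renaming of letters. An $(r,s)$-formation is a concatenation of $s$ permutations, each of the same set of $r$ distinct letters. The formation width $fw(u)$ is the minimum $s$ such that there exists $r$ for which every $(r,s)$-formation contains $u$. A sequence has alternation length $5$ if it contains $ababa$ (for distinct letters $a,b$) but does not contain $ababab$. Every sequence satisfying the hypotheses has length $2n+1$; its middle letter is its $(n+1)$-st letter. -}

module Defs where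

open import Data.Nat using (ℕ; zero; suc; _+_; _≤_; _<_; _≟_)
open import Data.List using (List; []; _∷_; map; concat; length; applyUpTo; filter)
open import Data.List.Membership.Propositional using (_∈_)
open import Data.List.Relation.Unary.All using (All)
open import Data.List.Relation.Unary.Unique.Propositional using (Unique)
open import Data.List.Relation.Binary.Sublist.Propositional using (_⊆_)
open import Data.List.Relation.Binary.Permutation.Propositional using (_↭_)
open import Data.Maybe using (Maybe; just; nothing)
open import Data.Product using (Σ; ∃; _×_)
open import Relation.Binary.PropositionalEquality using (_≡_)
open import Relation.Nullary using (¬_)

Seq : Set
Seq = List ℕ

Contains : Seq → Seq → Set
Contains s u = Σ (ℕ → ℕ) λ f →
  ((x y : ℕ) → x ∈ u → y ∈ u → f x ≡ f y → x ≡ y) × (map f u ⊆ s)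

IsFormation : ℕ → ℕ → Seq → Set
IsFormation r s f = Σ (List ℕ) λ L → length L ≡ r × Unique L ×
  Σ (List (List ℕ)) λ ps → length ps ≡ s × All (λ p → p ↭ L) ps × f ≡ concat ps

WidthWorks : Seq → ℕ → Set
WidthWorks u s = ∃ λ r → (f : Seq) → IsFormation r s f → Contains f u

FwIs : Seq → ℕ → Set
FwIs u k = WidthWorks u k × ((s : ℕ) → s < k → ¬ WidthWorks u s)

-- alternation length exactly 5: contains ababa, not ababab (a ≠ b,
-- enforced by injectivity of the renaming of the pattern 0 1 0 1 0)
AltLength5 : Seq → Set
AltLength5 u = Contains u (0 ∷ 1 ∷ 0 ∷ 1 ∷ 0 ∷ [])
             × ¬ Contains u (0 ∷ 1 ∷ 0 ∷ 1 ∷ 0 ∷ 1 ∷ [])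

count : ℕ → Seq → ℕ
count x u = length (filter (λ y → y ≟ x) u)

nth : Seq → ℕ → Maybe ℕ
nth [] _ = nothing
nth (x ∷ _) zero = just x
nth (_ ∷ xs) (suc k) = nth xs k

upto : ℕ → Seq
upto n = applyUpTo suc n

-- Write u = 1 2 … n 2 v 2. Since fw(u) = 4 there is an r such that u occurs, up to renaming, in
-- every (r,4)-formation, in particular in every concatenation of four blocks 1 … r or r … 1.
-- Hence a pattern that embeds into no such monotone formation does not occur in u. For a short
-- pattern this is decided mechanically: distribute it over the four blocks in every possible way
-- and find, for each distribution, a cycle in the order constraints the blocks impose.
-- Since every letter occurs twice, every letter other than 2 occurs in v. Excluding a handful of
-- patterns then shows that 2 does not occur in v, that v starts with 1, that 1 does not occur
-- again, and that the rest of v has no repeated letter and no inversion; an increasing list of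
-- exactly the letters 3, …, n is 3 … n.

module Submission where

open import Defs
open import Data.Bool using (Bool; true; T)
open import Data.Bool.ListAction using (all; any)
open import Data.Empty using (⊥; ⊥-elim)
open import Data.Maybe using (just)
open import Data.Nat using (ℕ; zero; suc; _≤_; _<_; _>_; _+_; _∸_; _≟_; _≡ᵇ_; z≤n; s≤s; s≤s⁻¹)
open import Data.Nat.Properties
  using ( <-trans; <-irrefl; <-asym; >⇒≢; <-cmp; ≤-trans; ≤-refl; <⇒≤; ≤∧≢⇒<
        ; <⇒≢; m≤m+n; +-monoʳ-<; +-cancelˡ-<; m+[n∸m]≡n; ≡ᵇ⇒≡)
open import Data.Product using (_×_; _,_; proj₁; proj₂; ∃; ∃₂; swap; map₁; uncurry)
open import Data.Sum using (_⊎_; inj₁; inj₂)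
import Data.Sum as Sum
open import Data.List
  using (List; []; _∷_; _++_; map; concat; length; applyUpTo; applyDownFrom; filter; take; drop; last; initLast; _∷ʳ′_)
open import Data.List.Properties using (length-map; length-applyUpTo; map-∘; map-++; reverse-applyUpTo; take++drop≡id)
open import Data.List.Membership.Propositional using (_∈_; _∉_)
open import Data.List.Membership.Propositional.Properties using (∈-map⁺; ∈-++⁺ˡ; ∈-++⁻; ∈-applyUpTo⁺; ∈-applyUpTo⁻)
open import Data.List.Relation.Unary.Any using (here; there)
import Data.List.Relation.Unary.Any as Any
open import Data.List.Relation.Unary.Any.Properties using (any⁻)
open import Data.List.Relation.Unary.All as All using (All; []; _∷_)
import Data.List.Relation.Unary.All.Properties as All
open import Data.List.Relation.Unary.AllPairs as AllPairs using (AllPairs; []; _∷_)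
import Data.List.Relation.Unary.AllPairs.Properties as AllPairs
open import Data.List.Relation.Unary.Linked using (Linked; [-]; _∷_)
open import Data.List.Relation.Unary.Linked.Properties using (Linked⇒AllPairs)
open import Data.List.Relation.Unary.Unique.Propositional using (Unique)
open import Data.List.Relation.Binary.Sublist.Propositional
  using (_⊆_; []; _∷_; _∷ʳ_; ⊆-refl; ⊆-trans; ⊆-antisym; minimum; to∈; from∈)
open import Data.List.Relation.Binary.Sublist.Propositional.Properties using (All-resp-⊆; map⁺; ++⁺; filter-⊆; ∷ˡ⁻)
open import Data.List.Relation.Binary.Permutation.Propositional using (_↭_; ↭-refl)
open import Data.List.Relation.Binary.Permutation.Propositional.Properties using (↭-reverse)
open import Function using (id; _∘_)
open import Relation.Binary.Definitions using (Tri; tri<; tri≈; tri>)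
open import Relation.Binary.PropositionalEquality using (_≡_; _≢_; refl; sym; trans; cong; subst)
open import Relation.Nullary using (¬_; yes; no)

private
  variable
    A B : Set
    x y z : A
    xs ys : List A

AllPairs-resp-⊆ : {R : A → A → Set} → xs ⊆ ys → AllPairs R ys → AllPairs R xs
AllPairs-resp-⊆ []         []         = []
AllPairs-resp-⊆ (y ∷ʳ τ)   (_ ∷ Rys)  = AllPairs-resp-⊆ τ Rys
AllPairs-resp-⊆ (refl ∷ τ) (Ry ∷ Rys) = All-resp-⊆ τ Ry ∷ AllPairs-resp-⊆ τ Rys

map-⊆-++⁻ : (f : A → B) (xs : List A) {ys zs : List B} → map f xs ⊆ ys ++ zs →
            ∃₂ λ as bs → xs ≡ as ++ bs × map f as ⊆ ys × map f bs ⊆ zs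
map-⊆-++⁻ f xs       {[]}     τ = [] , xs , refl , [] , τ
map-⊆-++⁻ f []       {y ∷ ys} τ = [] , [] , refl , minimum _ , minimum _
map-⊆-++⁻ f (x ∷ xs) {y ∷ ys} (.y ∷ʳ τ) with map-⊆-++⁻ f (x ∷ xs) τ
... | as , bs , eq , τ₁ , τ₂ = as , bs , eq , y ∷ʳ τ₁ , τ₂
map-⊆-++⁻ f (x ∷ xs) {y ∷ ys} (fx≡y ∷ τ) with map-⊆-++⁻ f xs τ
... | as , bs , eq , τ₁ , τ₂ = x ∷ as , bs , cong (x ∷_) eq , fx≡y ∷ τ₁ , τ₂

applyUpTo-+-increasing : ∀ k m → AllPairs _<_ (applyUpTo (k +_) m)
applyUpTo-+-increasing k m = AllPairs.applyUpTo⁺₁ (k +_) m (λ i<j _ → +-monoʳ-< k i<j)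

∈-tail : ∀ {y z zs} → y < z → z ∈ y ∷ zs → z ∈ zs
∈-tail y<z = Any.tail (>⇒≢ y<z)

⊆-sorted : AllPairs _<_ xs → AllPairs _<_ ys → All (_∈ ys) xs → xs ⊆ ys
⊆-sorted {xs = []}    _            _            _                  = minimum _
⊆-sorted {ys = []}    _            _            (() ∷ _)
⊆-sorted (x<xs ∷ xs↑) (_ ∷ ys↑)    (here refl ∷ xs∈)  =
  refl ∷ ⊆-sorted xs↑ ys↑ (All.zipWith (λ (x<z , z∈) → ∈-tail x<z z∈) (x<xs , xs∈))
⊆-sorted (x<xs ∷ xs↑) (y<ys ∷ ys↑) (there x∈ys ∷ xs∈) =
  _ ∷ʳ ⊆-sorted (x<xs ∷ xs↑) ys↑
         (x∈ys ∷ All.zipWith (λ (x<z , z∈) → ∈-tail (<-trans (All.lookup y<ys x∈ys) x<z) z∈) (x<xs , xs∈))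

AllPairs-from-⊆ : {R : A → A → Set} → (∀ {a b} → a ∷ b ∷ [] ⊆ xs → R a b) → AllPairs R xs
AllPairs-from-⊆ {xs = []}     R-pairs = []
AllPairs-from-⊆ {xs = x ∷ xs} R-pairs =
  All.tabulate (λ b∈xs → R-pairs (refl ∷ from∈ b∈xs)) ∷ AllPairs-from-⊆ (R-pairs ∘ (x ∷ʳ_))

⊆-pair : x ∈ xs → y ∈ xs → x ≢ y → (x ∷ y ∷ [] ⊆ xs) ⊎ (y ∷ x ∷ [] ⊆ xs)
⊆-pair (here refl) (here refl) x≢y = ⊥-elim (x≢y refl)
⊆-pair (here refl) (there y∈) _   = inj₁ (refl ∷ from∈ y∈)
⊆-pair (there x∈)  (here refl) _  = inj₂ (refl ∷ from∈ x∈)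
⊆-pair (there x∈)  (there y∈) x≢y = Sum.map (_ ∷ʳ_) (_ ∷ʳ_) (⊆-pair x∈ y∈ x≢y)

⊆-insert : x ∷ y ∷ [] ⊆ xs → z ∈ xs → z ≢ x → z ≢ y →
           (z ∷ x ∷ y ∷ [] ⊆ xs) ⊎ (x ∷ z ∷ y ∷ [] ⊆ xs) ⊎ (x ∷ y ∷ z ∷ [] ⊆ xs)
⊆-insert (_ ∷ʳ τ)   (here refl) _   _   = inj₁ (refl ∷ τ)
⊆-insert (_ ∷ʳ τ)   (there z∈)  z≢x z≢y = Sum.map (_ ∷ʳ_) (Sum.map (_ ∷ʳ_) (_ ∷ʳ_)) (⊆-insert τ z∈ z≢x z≢y)
⊆-insert (refl ∷ τ) (here refl) z≢x _   = ⊥-elim (z≢x refl)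
⊆-insert (refl ∷ τ) (there z∈)  _   z≢y = inj₂ (Sum.map (refl ∷_) (refl ∷_) (⊆-pair z∈ (to∈ τ) z≢y))

count≥2⇒⊆ : ∀ a u → 2 ≤ count a u → a ∷ a ∷ [] ⊆ u
count≥2⇒⊆ a u twice = ⊆-trans (repeated _ (All.all-filter (_≟ a) u) twice) (filter-⊆ (_≟ a) u)
  where
  repeated : ∀ ys → All (_≡ a) ys → 2 ≤ length ys → a ∷ a ∷ [] ⊆ ys
  repeated (_ ∷ _ ∷ ys) (refl ∷ refl ∷ _) _         = refl ∷ refl ∷ minimum ys
  repeated (_ ∷ [])     _                 (s≤s ())

repeated⇒∈ʳ : Unique xs → x ∷ x ∷ [] ⊆ xs ++ ys → x ∈ ys
repeated⇒∈ʳ {xs = xs} {x = x} xs! τ with map-⊆-++⁻ id (x ∷ x ∷ []) {xs} τ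
... | []          , _  , refl , _  , τ₂ = to∈ τ₂
... | (_ ∷ [])    , _  , refl , _  , τ₂ = to∈ τ₂
... | (_ ∷ _ ∷ []) , [] , refl , τ₁ , _ with AllPairs-resp-⊆ τ₁ xs!
...   | (x≢x ∷ []) ∷ _ = ⊥-elim (x≢x refl)

∈-applyUpTo-+⁺ : ∀ {k m n} → k ≤ n → n < k + m → n ∈ applyUpTo (k +_) m
∈-applyUpTo-+⁺ {k} {m} {n} k≤n n<k+m =
  subst (_∈ _) (m+[n∸m]≡n k≤n)
    (∈-applyUpTo⁺ (k +_) (+-cancelˡ-< k (n ∸ k) m (subst (_< k + m) (sym (m+[n∸m]≡n k≤n)) n<k+m)))

∈-applyUpTo-+⁻ : ∀ {k m n} → n ∈ applyUpTo (k +_) m → k ≤ n × n < k + m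
∈-applyUpTo-+⁻ {k} n∈ with ∈-applyUpTo⁻ (k +_) n∈
... | i , i<m , refl = m≤m+n k i , +-monoʳ-< k i<m

upto-unique : ∀ n → Unique (upto n)
upto-unique n = AllPairs.map <⇒≢ (applyUpTo-+-increasing 1 n)

increasing-⊆-upto : ∀ {n xs} → Linked _<_ (0 ∷ xs) → All (_≤ n) xs → xs ⊆ upto n
increasing-⊆-upto {n} chain bounded with Linked⇒AllPairs <-trans chain
... | 0<xs ∷ xs↑ =
  ⊆-sorted xs↑ (applyUpTo-+-increasing 1 n)
    (All.zipWith (λ (0<x , x≤n) → ∈-applyUpTo-+⁺ 0<x (s≤s x≤n)) (0<xs , bounded))

nth≡head-drop : ∀ (u : List ℕ) n → nth u n ≡ nth (drop n u) 0
nth≡head-drop []      zero    = refl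
nth≡head-drop []      (suc n) = refl
nth≡head-drop (x ∷ u) zero    = refl
nth≡head-drop (x ∷ u) (suc n) = nth≡head-drop u n

last-++-∷ : ∀ (xs : List ℕ) y ys → last (xs ++ y ∷ ys) ≡ last (y ∷ ys)
last-++-∷ []           y ys = refl
last-++-∷ (x ∷ [])     y ys = refl
last-++-∷ (x ∷ x′ ∷ xs) y ys = last-++-∷ (x′ ∷ xs) y ys

last≡⇒∷ʳ : ∀ y t {z} → last (y ∷ t) ≡ just z → t ≡ [] ⊎ ∃ λ v → t ≡ v ++ z ∷ []
last≡⇒∷ʳ y t end with initLast t
... | []      = inj₁ refl
... | v ∷ʳ′ x with trans (sym (last-++-∷ (y ∷ v) x [])) end
...   | refl = inj₂ (v , refl)

data Direction : Set where
  ↑ ↓ : Direction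

block : ℕ → Direction → List ℕ
block r ↑ = upto r
block r ↓ = applyDownFrom suc r

monotoneFormation : ℕ → List Direction → Seq
monotoneFormation r ds = concat (map (block r) ds)

block↭upto : ∀ r d → block r d ↭ upto r
block↭upto r ↑ = ↭-refl
block↭upto r ↓ = subst (_↭ upto r) (reverse-applyUpTo suc r) (↭-reverse (upto r))

monotoneFormation-isFormation : ∀ r ds → IsFormation r (length ds) (monotoneFormation r ds)
monotoneFormation-isFormation r ds =
  upto r , length-applyUpTo suc r , upto-unique r ,
  map (block r) ds , length-map (block r) ds ,
  All.map⁺ (All.universal (block↭upto r) ds) , refl

orderedPairs : List A → List (A × A)
orderedPairs []       = []
orderedPairs (x ∷ xs) = map (x ,_) xs ++ orderedPairs xs

AllPairs⇒All-orderedPairs : {R : A → A → Set} → AllPairs R xs → All (uncurry R) (orderedPairs xs)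
AllPairs⇒All-orderedPairs []          = []
AllPairs⇒All-orderedPairs (Rx ∷ Rxs) = All.++⁺ (All.map⁺ Rx) (AllPairs⇒All-orderedPairs Rxs)

Satisfies : (ℕ → ℕ) → List (ℕ × ℕ) → Set
Satisfies f = All (λ (a , b) → f a < f b)

blockConstraints : Direction → List ℕ → List (ℕ × ℕ)
blockConstraints ↑ p = orderedPairs p
blockConstraints ↓ p = map swap (orderedPairs p)

blockConstraints-sound : ∀ {f r} d p → map f p ⊆ block r d → Satisfies f (blockConstraints d p)
blockConstraints-sound {r = r} ↑ p τ =
  AllPairs⇒All-orderedPairs (AllPairs.map⁻ (AllPairs-resp-⊆ τ (applyUpTo-+-increasing 1 r)))
blockConstraints-sound {r = r} ↓ p τ =
  All.map⁺ (AllPairs⇒All-orderedPairs (AllPairs.map⁻ (AllPairs-resp-⊆ τ decreasing)))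
  where
  decreasing : AllPairs _>_ (applyDownFrom suc r)
  decreasing = AllPairs.applyDownFrom⁺₁ suc r (λ j<i _ → s≤s j<i)

successors : ℕ → List (ℕ × ℕ) → List ℕ
successors b C = map proj₂ (filter (λ e → proj₁ e ≟ b) C)

_⨾_ : List (ℕ × ℕ) → List (ℕ × ℕ) → List (ℕ × ℕ)
[]            ⨾ C = []
((a , b) ∷ R) ⨾ C = map (a ,_) (successors b C) ++ R ⨾ C

successors-sound : ∀ {f b} C → Satisfies f C → All (λ d → f b < f d) (successors b C)
successors-sound {b = b} C sat =
  All.map⁺ (All.map (λ { (lt , refl) → lt })
    (All.zip (All.filter⁺ (λ e → proj₁ e ≟ b) sat , All.all-filter (λ e → proj₁ e ≟ b) C)))

⨾-sound : ∀ {f R C} → Satisfies f R → Satisfies f C → Satisfies f (R ⨾ C)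
⨾-sound []        sC = []
⨾-sound (ab ∷ sR) sC = All.++⁺ (All.map⁺ (All.map (<-trans ab) (successors-sound _ sC))) (⨾-sound sR sC)

hasLoop : List (ℕ × ℕ) → Bool
hasLoop = any (λ (a , b) → a ≡ᵇ b)

hasLoop-sound : ∀ {f} C → T (hasLoop C) → ¬ Satisfies f C
hasLoop-sound {f} C loop sat =
  All.lookupWith (λ {(a , b)} lt a≡b → <-irrefl (cong f (≡ᵇ⇒≡ a b a≡b)) lt) sat (any⁻ _ C loop)

-- Every cycle of length at most three among the constraints shows up as a loop.
contradictory : List (ℕ × ℕ) → Bool
contradictory C = hasLoop (C₃ ++ C₃ ⨾ C)
  where
  C₃ : List (ℕ × ℕ)
  C₃ = C ++ C ⨾ C

contradictory-sound : ∀ {f} C → T (contradictory C) → ¬ Satisfies f C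
contradictory-sound {f} C t sat = hasLoop-sound _ t (All.++⁺ sat₃ (⨾-sound sat₃ sat))
  where
  sat₃ : Satisfies f (C ++ C ⨾ C)
  sat₃ = All.++⁺ sat (⨾-sound sat sat)

splits : List A → List (List A × List A)
splits []       = ([] , []) ∷ []
splits (x ∷ xs) = ([] , x ∷ xs) ∷ map (map₁ (x ∷_)) (splits xs)

∈-splits : (xs ys : List A) → (xs , ys) ∈ splits (xs ++ ys)
∈-splits []       []       = here refl
∈-splits []       (y ∷ ys) = here refl
∈-splits (x ∷ xs) ys       = there (∈-map⁺ (map₁ (x ∷_)) (∈-splits xs ys))

avoids : List Direction → List (ℕ × ℕ) → List ℕ → Bool
avoids []       C []      = contradictory C
avoids []       C (_ ∷ _) = true
avoids (d ∷ ds) C q       = all (λ (p , q′) → avoids ds (blockConstraints d p ++ C) q′) (splits q)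

avoids-sound : ∀ {f r} ds C q → T (avoids ds C q) → Satisfies f C → ¬ map f q ⊆ monotoneFormation r ds
avoids-sound []       C []      t sat _ = contradictory-sound C t sat
avoids-sound []       C (_ ∷ _) t sat ()
avoids-sound {f} {r} (d ∷ ds) C q t sat τ with map-⊆-++⁻ f q {block r d} τ
... | p , q′ , refl , τ₁ , τ₂ =
  avoids-sound {r = r} ds _ q′ (All.lookup (All.all⁺ _ (splits (p ++ q′)) t) (∈-splits p q′))
    (All.++⁺ (blockConstraints-sound {r = r} d p τ₁) sat) τ₂

avoided-pattern-absent : ∀ {u} ds q → T (avoids ds [] q) → WidthWorks u (length ds) →
                         (g : ℕ → ℕ) → ¬ map g q ⊆ u
avoided-pattern-absent ds q t (r , contains) g τ with contains _ (monotoneFormation-isFormation r ds)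
... | f , _ , σ = avoids-sound ds [] q t [] (subst (_⊆ _) (sym (map-∘ q)) (⊆-trans (map⁺ f τ) σ))

framed : ℕ → List ℕ → Seq
framed n v = upto n ++ 2 ∷ v ++ 2 ∷ []

-- Patterns are written over the letters 1 … 5: 1 and 2 stand for themselves, 3, 4, 5 for a, b, c.
instantiate : ℕ → ℕ → ℕ → ℕ → ℕ
instantiate a b c 3 = a
instantiate a b c 4 = b
instantiate a b c 5 = c
instantiate a b c k = k

above-2 : ∀ {x} → 1 ≤ x → x ≢ 1 → x ≢ 2 → 2 < x
above-2 1≤x x≢1 x≢2 = ≤∧≢⇒< (≤∧≢⇒< 1≤x (x≢1 ∘ sym)) (x≢2 ∘ sym)

third-letter : ∀ x y → ∃ λ z → 2 < z × z ≤ 5 × z ≢ x × z ≢ y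
third-letter x y with 3 ≟ x | 3 ≟ y | 4 ≟ x | 4 ≟ y
... | no 3≢x   | no 3≢y   | _        | _        = 3 , s≤s (s≤s (s≤s z≤n)) , s≤s (s≤s (s≤s z≤n)) , 3≢x , 3≢y
... | _        | _        | no 4≢x   | no 4≢y   = 4 , s≤s (s≤s (s≤s z≤n)) , s≤s (s≤s (s≤s (s≤s z≤n))) , 4≢x , 4≢y
... | yes refl | _        | no _     | yes refl = 5 , s≤s (s≤s (s≤s z≤n)) , ≤-refl , (λ ()) , (λ ())
... | no _     | yes refl | yes refl | _        = 5 , s≤s (s≤s (s≤s z≤n)) , ≤-refl , (λ ()) , (λ ())
... | yes refl | _        | yes ()   | _
... | no _     | yes refl | no _     | yes ()

module Segment (n : ℕ) (6≤n : 6 ≤ n) (v : List ℕ)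
  (width4 : WidthWorks (framed n v) 4)
  (v-letters : All (λ x → 1 ≤ x × x ≤ n) v)
  (v-complete : ∀ {x} → 1 ≤ x → x ≤ n → x ≢ 2 → x ∈ v) where

  2≤n : 2 ≤ n
  2≤n = ≤-trans (s≤s (s≤s z≤n)) 6≤n

  5≤n : 5 ≤ n
  5≤n = ≤-trans (s≤s (s≤s (s≤s (s≤s (s≤s z≤n))))) 6≤n

  excluded : ∀ d₁ d₂ d₃ d₄ q {_ : T (avoids (d₁ ∷ d₂ ∷ d₃ ∷ d₄ ∷ []) [] q)} (g : ℕ → ℕ) →
             ¬ map g q ⊆ framed n v
  excluded d₁ d₂ d₃ d₄ q {certificate} =
    avoided-pattern-absent (d₁ ∷ d₂ ∷ d₃ ∷ d₄ ∷ []) q certificate width4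

  ⊆-framed : ∀ {pre mid} → pre ⊆ upto n → mid ⊆ v → pre ++ 2 ∷ mid ++ 2 ∷ [] ⊆ framed n v
  ⊆-framed τ σ = ++⁺ τ (refl ∷ ++⁺ σ ⊆-refl)

  1≤n : 1 ≤ n
  1≤n = ≤-trans (s≤s z≤n) 2≤n

  prefix-⊆ : ∀ {xs} → Linked _<_ (2 ∷ xs) → All (_≤ n) xs → 1 ∷ 2 ∷ xs ⊆ upto n
  prefix-⊆ chain bounded = increasing-⊆-upto (s≤s z≤n ∷ s≤s (s≤s z≤n) ∷ chain) (1≤n ∷ 2≤n ∷ bounded)

  1∈v : 1 ∈ v
  1∈v = v-complete (s≤s z≤n) 1≤n (λ ())

  2∉v : 2 ∉ v
  2∉v 2∈v with ⊆-pair 1∈v 2∈v (λ ())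
  ... | inj₁ τ = excluded ↑ ↑ ↓ ↑ (1 ∷ 2 ∷ 2 ∷ 1 ∷ 2 ∷ 2 ∷ []) id (⊆-framed (prefix-⊆ [-] []) τ)
  ... | inj₂ τ = excluded ↑ ↑ ↑ ↓ (1 ∷ 2 ∷ 2 ∷ 2 ∷ 1 ∷ 2 ∷ []) id (⊆-framed (prefix-⊆ [-] []) τ)

  starts-with-1 : ∃ λ w → v ≡ 1 ∷ w
  starts-with-1 = head-1 v refl 1∈v v-letters
    where
    head-1 : ∀ v′ → v′ ≡ v → 1 ∈ v′ → All (λ x → 1 ≤ x × x ≤ n) v′ → ∃ λ w → v′ ≡ 1 ∷ w
    head-1 (h ∷ w) v′≡v 1∈hw ((1≤h , h≤n) ∷ _) with h ≟ 1
    ... | yes refl = w , refl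
    ... | no h≢1   =
      ⊥-elim (excluded ↑ ↓ ↑ ↓ (1 ∷ 2 ∷ 3 ∷ 2 ∷ 3 ∷ 1 ∷ 2 ∷ []) (instantiate h 0 0)
        (⊆-framed (prefix-⊆ (2<h ∷ [-]) (h≤n ∷ []))
               (subst (h ∷ 1 ∷ [] ⊆_) v′≡v (refl ∷ from∈ (Any.tail (h≢1 ∘ sym) 1∈hw)))))
      where
      2<h : 2 < h
      2<h = above-2 1≤h h≢1 (λ { refl → 2∉v (subst (2 ∈_) v′≡v (here refl)) })

module SegmentAfter1 (n : ℕ) (6≤n : 6 ≤ n) (w : List ℕ)
  (width4 : WidthWorks (framed n (1 ∷ w)) 4)
  (v-letters : All (λ x → 1 ≤ x × x ≤ n) (1 ∷ w))
  (v-complete : ∀ {x} → 1 ≤ x → x ≤ n → x ≢ 2 → x ∈ 1 ∷ w) where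

  open Segment n 6≤n (1 ∷ w) width4 v-letters v-complete

  1∉w : 1 ∉ w
  1∉w 1∈w =
    excluded ↑ ↑ ↓ ↓ (1 ∷ 2 ∷ 2 ∷ 1 ∷ 1 ∷ 2 ∷ []) id (⊆-framed (prefix-⊆ [-] []) (refl ∷ from∈ 1∈w))

  w-letter : ∀ {a} → a ∈ w → 2 < a × a ≤ n
  w-letter {a} a∈w with All.lookup (All.tail v-letters) a∈w
  ... | 1≤a , a≤n = above-2 1≤a (λ { refl → 1∉w a∈w }) (λ { refl → 2∉v (there a∈w) }) , a≤n

  w-complete : ∀ {x} → 2 < x → x ≤ n → x ∈ w
  w-complete (s≤s (s≤s (s≤s _))) x≤n = Any.tail (λ ()) (v-complete (s≤s z≤n) x≤n (λ ()))

  no-repeat : ∀ {a} → ¬ a ∷ a ∷ [] ⊆ w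
  no-repeat {a} τ with w-letter (to∈ τ)
  ... | 2<a , a≤n = excluded ↑ ↓ ↑ ↑ (2 ∷ 3 ∷ 2 ∷ 3 ∷ 3 ∷ 2 ∷ []) (instantiate a 0 0)
                      (⊆-framed (increasing-⊆-upto (s≤s z≤n ∷ 2<a ∷ [-]) (2≤n ∷ a≤n ∷ [])) (1 ∷ʳ τ))

  excluded-triple : ∀ {a b c} → a ∈ w → c ∈ w → a < b → b < c → ∀ d₁ d₂ d₃ d₄ π
                    {_ : T (avoids (d₁ ∷ d₂ ∷ d₃ ∷ d₄ ∷ []) [] (1 ∷ 2 ∷ 3 ∷ 4 ∷ 5 ∷ 2 ∷ 1 ∷ π ++ 2 ∷ []))} →
                    ¬ map (instantiate a b c) π ⊆ w
  excluded-triple {a} {b} {c} a∈w c∈w a<b b<c d₁ d₂ d₃ d₄ π {certificate} τ =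
    excluded d₁ d₂ d₃ d₄ (1 ∷ 2 ∷ 3 ∷ 4 ∷ 5 ∷ 2 ∷ 1 ∷ π ++ 2 ∷ []) {certificate} (instantiate a b c)
      (subst (λ tail → 1 ∷ 2 ∷ a ∷ b ∷ c ∷ 2 ∷ 1 ∷ tail ⊆ framed n (1 ∷ w)) (sym (map-++ _ π (2 ∷ [])))
        (⊆-framed (prefix-⊆ (2<a ∷ a<b ∷ b<c ∷ [-]) (a≤n ∷ ≤-trans (<⇒≤ b<c) c≤n ∷ c≤n ∷ [])) (refl ∷ τ)))
    where
    2<a : 2 < a
    2<a = proj₁ (w-letter a∈w)
    a≤n : a ≤ n
    a≤n = proj₂ (w-letter a∈w)
    c≤n : c ≤ n
    c≤n = proj₂ (w-letter c∈w)

  -- Wherever a third letter z sits, in value and in position, the triple forms an excluded pattern.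
  no-inversion : ∀ {x y} → x < y → ¬ y ∷ x ∷ [] ⊆ w
  no-inversion {x} {y} x<y τ with third-letter x y
  ... | z , 2<z , z≤5 , z≢x , z≢y =
    unsorted (⊆-insert τ z∈w z≢y z≢x) (<-cmp z x) (<-cmp z y)
    where
    x∈w : x ∈ w
    x∈w = to∈ (∷ˡ⁻ τ)
    y∈w : y ∈ w
    y∈w = to∈ τ
    z∈w : z ∈ w
    z∈w = w-complete 2<z (≤-trans z≤5 5≤n)
    unsorted : (z ∷ y ∷ x ∷ [] ⊆ w) ⊎ (y ∷ z ∷ x ∷ [] ⊆ w) ⊎ (y ∷ x ∷ z ∷ [] ⊆ w) →
               Tri (z < x) (z ≡ x) (z > x) → Tri (z < y) (z ≡ y) (z > y) → ⊥
    unsorted _                (tri≈ _ z≡x _) _              = z≢x z≡x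
    unsorted _                _              (tri≈ _ z≡y _) = z≢y z≡y
    unsorted _                (tri< z<x _ _) (tri> _ _ y<z) = <-asym x<y (<-trans y<z z<x)
    unsorted (inj₁ zyx)        (tri< z<x _ _) _              = excluded-triple z∈w y∈w z<x x<y ↑ ↑ ↓ ↑ (3 ∷ 5 ∷ 4 ∷ []) zyx
    unsorted (inj₂ (inj₁ yzx)) (tri< z<x _ _) _              = excluded-triple z∈w y∈w z<x x<y ↑ ↓ ↓ ↑ (5 ∷ 3 ∷ 4 ∷ []) yzx
    unsorted (inj₂ (inj₂ yxz)) (tri< z<x _ _) _              = excluded-triple z∈w y∈w z<x x<y ↑ ↑ ↑ ↑ (5 ∷ 4 ∷ 3 ∷ []) yxz
    unsorted (inj₁ zyx)        (tri> _ _ x<z) (tri< z<y _ _) = excluded-triple x∈w y∈w x<z z<y ↑ ↑ ↓ ↑ (4 ∷ 5 ∷ 3 ∷ []) zyx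
    unsorted (inj₂ (inj₁ yzx)) (tri> _ _ x<z) (tri< z<y _ _) = excluded-triple x∈w y∈w x<z z<y ↑ ↑ ↑ ↑ (5 ∷ 4 ∷ 3 ∷ []) yzx
    unsorted (inj₂ (inj₂ yxz)) (tri> _ _ x<z) (tri< z<y _ _) = excluded-triple x∈w y∈w x<z z<y ↑ ↓ ↓ ↑ (5 ∷ 3 ∷ 4 ∷ []) yxz
    unsorted (inj₁ zyx)        (tri> _ _ x<z) (tri> _ _ y<z) = excluded-triple x∈w z∈w x<y y<z ↑ ↑ ↑ ↑ (5 ∷ 4 ∷ 3 ∷ []) zyx
    unsorted (inj₂ (inj₁ yzx)) (tri> _ _ x<z) (tri> _ _ y<z) = excluded-triple x∈w z∈w x<y y<z ↑ ↑ ↓ ↑ (4 ∷ 5 ∷ 3 ∷ []) yzx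
    unsorted (inj₂ (inj₂ yxz)) (tri> _ _ x<z) (tri> _ _ y<z) = excluded-triple x∈w z∈w x<y y<z ↑ ↑ ↑ ↓ (4 ∷ 3 ∷ 5 ∷ []) yxz

  w-increasing : AllPairs _<_ w
  w-increasing = AllPairs-from-⊆ increasing-pair
    where
    increasing-pair : ∀ {a b} → a ∷ b ∷ [] ⊆ w → a < b
    increasing-pair {a} {b} τ with <-cmp a b
    ... | tri< a<b _ _ = a<b
    ... | tri≈ _ refl _ = ⊥-elim (no-repeat τ)
    ... | tri> _ _ b<a = ⊥-elim (no-inversion b<a τ)

  3+[n∸2]≡1+n : 3 + (n ∸ 2) ≡ suc n
  3+[n∸2]≡1+n = cong suc (m+[n∸m]≡n 2≤n)

  ∈-interval⁺ : ∀ {x} → 2 < x → x ≤ n → x ∈ applyUpTo (3 +_) (n ∸ 2)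
  ∈-interval⁺ {x} 2<x x≤n = ∈-applyUpTo-+⁺ 2<x (subst (x <_) (sym 3+[n∸2]≡1+n) (s≤s x≤n))

  ∈-interval⁻ : ∀ {x} → x ∈ applyUpTo (3 +_) (n ∸ 2) → 2 < x × x ≤ n
  ∈-interval⁻ {x} x∈ with ∈-applyUpTo-+⁻ x∈
  ... | 2<x , x<3+[n∸2] = 2<x , s≤s⁻¹ (subst (x <_) 3+[n∸2]≡1+n x<3+[n∸2])

  w≡interval : w ≡ applyUpTo (3 +_) (n ∸ 2)
  w≡interval = ⊆-antisym
    (⊆-sorted w-increasing (applyUpTo-+-increasing 3 (n ∸ 2)) (All.tabulate (uncurry ∈-interval⁺ ∘ w-letter)))
    (⊆-sorted (applyUpTo-+-increasing 3 (n ∸ 2)) w-increasing (All.tabulate (uncurry w-complete ∘ ∈-interval⁻)))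

split-at-middle : ∀ n u → take n u ≡ upto n → nth u n ≡ just 2 → ∃ λ t → u ≡ upto n ++ 2 ∷ t
split-at-middle n u prefix middle with drop n u | take++drop≡id n u | trans (sym (nth≡head-drop u n)) middle
... | .2 ∷ t | u≡ | refl = t , trans (sym u≡) (cong (_++ 2 ∷ t) prefix)

repeated⇒∈-suffix : ∀ {n t x} → (∀ y → y ∈ upto n ++ t → 2 ≤ count y (upto n ++ t)) →
                     1 ≤ x → x ≤ n → x ∈ t
repeated⇒∈-suffix {n} twice 1≤x x≤n =
  repeated⇒∈ʳ (upto-unique n) (count≥2⇒⊆ _ _ (twice _ (∈-++⁺ˡ (∈-applyUpTo-+⁺ 1≤x (s≤s x≤n)))))

framed-shape : ∀ n u → 1 ≤ n → take n u ≡ upto n → nth u n ≡ just 2 → last u ≡ just 2 →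
               (∀ x → x ∈ u → 2 ≤ count x u) → ∃ λ v → u ≡ framed n v
framed-shape n u 1≤n prefix middle end twice with split-at-middle n u prefix middle
... | t , refl with last≡⇒∷ʳ 2 t (trans (sym (last-++-∷ (upto n) 2 t)) end)
...   | inj₂ (v , refl) = v , refl
...   | inj₁ refl with repeated⇒∈-suffix twice (s≤s z≤n) 1≤n
...     | here ()
...     | there ()

framed-complete : ∀ {n v} → (∀ y → y ∈ framed n v → 2 ≤ count y (framed n v)) →
                  ∀ {x} → 1 ≤ x → x ≤ n → x ≢ 2 → x ∈ v
framed-complete {v = v} twice 1≤x x≤n x≢2 with repeated⇒∈-suffix twice 1≤x x≤n
... | here x≡2 = ⊥-elim (x≢2 x≡2)
... | there x∈v++2 with ∈-++⁻ v x∈v++2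
...   | inj₁ x∈v       = x∈v
...   | inj₂ (here x≡2) = ⊥-elim (x≢2 x≡2)

middle-segment : ∀ n → 6 ≤ n → ∀ v → WidthWorks (framed n v) 4 → All (λ x → 1 ≤ x × x ≤ n) v →
                 (∀ {x} → 1 ≤ x → x ≤ n → x ≢ 2 → x ∈ v) → v ≡ 1 ∷ applyUpTo (3 +_) (n ∸ 2)
middle-segment n 6≤n v width4 letters complete with Segment.starts-with-1 n 6≤n v width4 letters complete
... | w , refl = cong (1 ∷_) (SegmentAfter1.w≡interval n 6≤n w width4 letters complete)

lemma20 : (n : ℕ) → 6 ≤ n → (u : List ℕ)
    → All (λ x → 1 ≤ x × x ≤ n) u
    → take n u ≡ upto n
    → ((x : ℕ) → x ∈ u → 2 ≤ count x u)
    → FwIs u 4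
    → AltLength5 u
    → last u ≡ just 2
    → nth u n ≡ just 2
    → u ≡ upto n ++ (2 ∷ 1 ∷ applyUpTo (λ i → 3 + i) (n ∸ 2) ++ (2 ∷ []))
lemma20 n 6≤n u letters prefix twice (width4 , _) _ end middle
  with framed-shape n u (≤-trans (s≤s z≤n) 6≤n) prefix middle end twice
... | v , refl = cong (framed n)
  (middle-segment n 6≤n v width4 (All.++⁻ˡ v (All.tail (All.++⁻ʳ (upto n) letters))) (framed-complete twice))
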